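{- Let $F$ be a formula of intuitionistic (minimal) propositional logic built from atomic formulas and $\top$ using $\wedge,\vee,\to$. If $[\![F]\!]=1$, then $F\cong\top$.
   Context: The interpretation $[\![-]\!]$ maps formulas to natural numbers: $[\![P]\!]=2$ for atomic $P$, $[\![\top]\!]=1$, $[\![F\vee G]\!]=[\![F]\!]+[\![G]\!]$, $[\![F\wedge G]\!]=[\![F]\!]\cdot[\![G]\!]$, $[\![G\to F]\!]=[\![F]\!]^{[\![G]\!]}$. Two formulas $F,G$ are isomorphic, $F\cong G$, if there are proofs (terms of the simply typed $\lambda$-calculus with product, sum and unit types) $\phi$ of $F\to G$ and $\psi$ of $G\to F$ such that both composites $\psi\circ\phi$ and $\phi\circ\psi$ are $\beta\eta$-equal to the identity. -}

module Defs where

open import Data.Nat using (ℕ; _+_; _*_; _^_)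
open import Data.List using (List; []; _∷_)

infixr 5 _⇒_
infixr 7 _∧_
infixr 6 _∨_

data Formula : Set where
  atom : ℕ → Formula
  ⊤̇    : Formula
  _∧_  : Formula → Formula → Formula
  _∨_  : Formula → Formula → Formula
  _⇒_  : Formula → Formula → Formula

⟦_⟧ : Formula → ℕ
⟦ atom _ ⟧ = 2
⟦ ⊤̇ ⟧ = 1
⟦ F ∨ G ⟧ = ⟦ F ⟧ + ⟦ G ⟧
⟦ F ∧ G ⟧ = ⟦ F ⟧ * ⟦ G ⟧
⟦ G ⇒ F ⟧ = ⟦ F ⟧ ^ ⟦ G ⟧

Ctx : Set
Ctx = List Formula

infix 4 _∋_
data _∋_ : Ctx → Formula → Set where
  here  : ∀ {Γ A} → (A ∷ Γ) ∋ A
  there : ∀ {Γ A B} → Γ ∋ A → (B ∷ Γ) ∋ A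

infix 4 _⊢_
data _⊢_ (Γ : Ctx) : Formula → Set where
  var  : ∀ {A} → Γ ∋ A → Γ ⊢ A
  lam  : ∀ {A B} → (A ∷ Γ) ⊢ B → Γ ⊢ A ⇒ B
  app  : ∀ {A B} → Γ ⊢ A ⇒ B → Γ ⊢ A → Γ ⊢ B
  unit : Γ ⊢ ⊤̇
  pair : ∀ {A B} → Γ ⊢ A → Γ ⊢ B → Γ ⊢ A ∧ B
  fst  : ∀ {A B} → Γ ⊢ A ∧ B → Γ ⊢ A
  snd  : ∀ {A B} → Γ ⊢ A ∧ B → Γ ⊢ B
  inl  : ∀ {A B} → Γ ⊢ A → Γ ⊢ A ∨ B
  inr  : ∀ {A B} → Γ ⊢ B → Γ ⊢ A ∨ B
  case : ∀ {A B C} → Γ ⊢ A ∨ B → (A ∷ Γ) ⊢ C → (B ∷ Γ) ⊢ C → Γ ⊢ C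

Ren : Ctx → Ctx → Set
Ren Γ Δ = ∀ {A} → Γ ∋ A → Δ ∋ A

extR : ∀ {Γ Δ B} → Ren Γ Δ → Ren (B ∷ Γ) (B ∷ Δ)
extR ρ here = here
extR ρ (there x) = there (ρ x)

rename : ∀ {Γ Δ A} → Ren Γ Δ → Γ ⊢ A → Δ ⊢ A
rename ρ (var x) = var (ρ x)
rename ρ (lam t) = lam (rename (extR ρ) t)
rename ρ (app t u) = app (rename ρ t) (rename ρ u)
rename ρ unit = unit
rename ρ (pair t u) = pair (rename ρ t) (rename ρ u)
rename ρ (fst t) = fst (rename ρ t)
rename ρ (snd t) = snd (rename ρ t)
rename ρ (inl t) = inl (rename ρ t)
rename ρ (inr t) = inr (rename ρ t)
rename ρ (case t u v) = case (rename ρ t) (rename (extR ρ) u) (rename (extR ρ) v)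

wk : ∀ {Γ A B} → Γ ⊢ A → (B ∷ Γ) ⊢ A
wk = rename there

Sub : Ctx → Ctx → Set
Sub Γ Δ = ∀ {A} → Γ ∋ A → Δ ⊢ A

extS : ∀ {Γ Δ B} → Sub Γ Δ → Sub (B ∷ Γ) (B ∷ Δ)
extS σ here = var here
extS σ (there x) = wk (σ x)

subst : ∀ {Γ Δ A} → Sub Γ Δ → Γ ⊢ A → Δ ⊢ A
subst σ (var x) = σ x
subst σ (lam t) = lam (subst (extS σ) t)
subst σ (app t u) = app (subst σ t) (subst σ u)
subst σ unit = unit
subst σ (pair t u) = pair (subst σ t) (subst σ u)
subst σ (fst t) = fst (subst σ t)
subst σ (snd t) = snd (subst σ t)
subst σ (inl t) = inl (subst σ t)
subst σ (inr t) = inr (subst σ t)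
subst σ (case t u v) = case (subst σ t) (subst (extS σ) u) (subst (extS σ) v)

_[_] : ∀ {Γ A B} → (A ∷ Γ) ⊢ B → Γ ⊢ A → Γ ⊢ B
_[_] {Γ} {A} t u = subst σ t
  where
  σ : Sub (A ∷ Γ) Γ
  σ here = u
  σ (there x) = var x

_⟨_⟩ : ∀ {Γ A B C} → (A ∷ Γ) ⊢ B → (C ∷ Γ) ⊢ A → (C ∷ Γ) ⊢ B
_⟨_⟩ {Γ} {A} {B} {C} t s = subst σ t
  where
  σ : Sub (A ∷ Γ) (C ∷ Γ)
  σ here = s
  σ (there x) = var (there x)

infix 3 _≈_
data _≈_ {Γ : Ctx} : ∀ {A} → Γ ⊢ A → Γ ⊢ A → Set where
  ≈-refl  : ∀ {A} {t : Γ ⊢ A} → t ≈ t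
  ≈-sym   : ∀ {A} {t u : Γ ⊢ A} → t ≈ u → u ≈ t
  ≈-trans : ∀ {A} {t u v : Γ ⊢ A} → t ≈ u → u ≈ v → t ≈ v
  lam-cong  : ∀ {A B} {t t' : (A ∷ Γ) ⊢ B} → t ≈ t' → lam t ≈ lam t'
  app-cong  : ∀ {A B} {t t' : Γ ⊢ A ⇒ B} {u u' : Γ ⊢ A} →
              t ≈ t' → u ≈ u' → app t u ≈ app t' u'
  pair-cong : ∀ {A B} {t t' : Γ ⊢ A} {u u' : Γ ⊢ B} →
              t ≈ t' → u ≈ u' → pair t u ≈ pair t' u'
  fst-cong  : ∀ {A B} {t t' : Γ ⊢ A ∧ B} → t ≈ t' → fst t ≈ fst t'
  snd-cong  : ∀ {A B} {t t' : Γ ⊢ A ∧ B} → t ≈ t' → snd t ≈ snd t'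
  inl-cong  : ∀ {A B} {t t' : Γ ⊢ A} → t ≈ t' → inl {B = B} t ≈ inl t'
  inr-cong  : ∀ {A B} {t t' : Γ ⊢ B} → t ≈ t' → inr {A = A} t ≈ inr t'
  case-cong : ∀ {A B C} {t t' : Γ ⊢ A ∨ B} {u u' : (A ∷ Γ) ⊢ C}
              {v v' : (B ∷ Γ) ⊢ C} →
              t ≈ t' → u ≈ u' → v ≈ v' → case t u v ≈ case t' u' v'
  β-⇒  : ∀ {A B} (t : (A ∷ Γ) ⊢ B) (u : Γ ⊢ A) → app (lam t) u ≈ t [ u ]
  β-∧₁ : ∀ {A B} (t : Γ ⊢ A) (u : Γ ⊢ B) → fst (pair t u) ≈ t
  β-∧₂ : ∀ {A B} (t : Γ ⊢ A) (u : Γ ⊢ B) → snd (pair t u) ≈ u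
  β-∨₁ : ∀ {A B C} (t : Γ ⊢ A) (u : (A ∷ Γ) ⊢ C) (v : (B ∷ Γ) ⊢ C) →
         case (inl t) u v ≈ u [ t ]
  β-∨₂ : ∀ {A B C} (t : Γ ⊢ B) (u : (A ∷ Γ) ⊢ C) (v : (B ∷ Γ) ⊢ C) →
         case (inr t) u v ≈ v [ t ]
  η-⇒  : ∀ {A B} (t : Γ ⊢ A ⇒ B) → t ≈ lam (app (wk t) (var here))
  η-∧  : ∀ {A B} (t : Γ ⊢ A ∧ B) → t ≈ pair (fst t) (snd t)
  η-⊤  : (t : Γ ⊢ ⊤̇) → t ≈ unit
  η-∨  : ∀ {A B C} (t : Γ ⊢ A ∨ B) (u : ((A ∨ B) ∷ Γ) ⊢ C) →
         u [ t ] ≈ case t (u ⟨ inl (var here) ⟩) (u ⟨ inr (var here) ⟩)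

Proof : Formula → Set
Proof F = [] ⊢ F

idP : ∀ {F} → Proof (F ⇒ F)
idP = lam (var here)

_∘P_ : ∀ {F G H} → Proof (G ⇒ H) → Proof (F ⇒ G) → Proof (F ⇒ H)
ψ ∘P φ = lam (app (wk ψ) (app (wk φ) (var here)))

record _≅_ (F G : Formula) : Set where
  field
    φ : Proof (F ⇒ G)
    ψ : Proof (G ⇒ F)
    ψ∘φ≈id : (ψ ∘P φ) ≈ idP
    φ∘ψ≈id : (φ ∘P ψ) ≈ idP

module Submission where

-- Call F *terminal* when every context Γ has a canonical proof of F and
-- every proof of F in Γ is βη-equal to it.  Terminal formulas are
-- isomorphic to ⊤: the isomorphism is λx.unit one way and the canonical
-- proof the other way; both round trips are the identity because each is
-- a proof of a terminal formula (F, resp. ⊤) under a λ.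
--
-- Terminal formulas are closed under ⊤ (η for ⊤), ∧ (η for ∧) and G ⇒ −
-- for any G (η for ⇒).  Arithmetically, every ⟦ F ⟧ is positive, hence
-- ⟦ F ∨ G ⟧ ≥ 2, ⟦ atom ⟧ = 2, ⟦ F ∧ G ⟧ = 1 forces both factors to be 1,
-- and ⟦ G ⇒ F ⟧ = 1 forces ⟦ F ⟧ = 1.  So by induction on F, ⟦ F ⟧ = 1
-- makes F terminal, and the theorem follows.

open import Defs
open import Relation.Binary.PropositionalEquality using (_≡_) renaming (subst to subst-≡)
open import Relation.Nullary using (¬_; contradiction)
open import Data.Nat using (_+_; _^_; _≤_; _<_; z≤n; s≤s; >-nonZero)
open import Data.Nat.Properties
  using (≤-trans; m≤m+n; +-mono-≤; *-mono-≤; 1+n≰n; m^n>0; >⇒≢;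
         m*n≡1⇒m≡1; m*n≡1⇒n≡1; m^n≡1⇒n≡0∨m≡1)
open import Data.Sum using (inj₁; inj₂)
open import Data.List using ([]; _∷_)

⟦⟧-positive : ∀ F → 0 < ⟦ F ⟧
⟦⟧-positive (atom _) = s≤s z≤n
⟦⟧-positive ⊤̇       = s≤s z≤n
⟦⟧-positive (F ∧ G) = *-mono-≤ (⟦⟧-positive F) (⟦⟧-positive G)
⟦⟧-positive (F ∨ G) = ≤-trans (⟦⟧-positive F) (m≤m+n ⟦ F ⟧ ⟦ G ⟧)
⟦⟧-positive (G ⇒ F) = m^n>0 ⟦ F ⟧ {{>-nonZero (⟦⟧-positive F)}} ⟦ G ⟧

positive-sum≢1 : ∀ {m n} → 0 < m → 0 < n → ¬ (m + n ≡ 1)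
positive-sum≢1 0<m 0<n m+n≡1 = 1+n≰n (subst-≡ (2 ≤_) m+n≡1 (+-mono-≤ 0<m 0<n))

positive-power≡1 : ∀ m {n} → 0 < n → m ^ n ≡ 1 → m ≡ 1
positive-power≡1 m {n} 0<n mⁿ≡1 with m^n≡1⇒n≡0∨m≡1 m n mⁿ≡1
... | inj₁ n≡0 = contradiction n≡0 (>⇒≢ 0<n)
... | inj₂ m≡1 = m≡1

record Terminal (F : Formula) : Set where
  field
    canonical : ∀ Γ → Γ ⊢ F
    unique    : ∀ {Γ} (t : Γ ⊢ F) → t ≈ canonical Γ
open Terminal

terminal-irrelevant : ∀ {F Γ} → Terminal F → (t t' : Γ ⊢ F) → t ≈ t'
terminal-irrelevant T t t' = ≈-trans (unique T t) (≈-sym (unique T t'))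

⊤-terminal : Terminal ⊤̇
⊤-terminal = record { canonical = λ _ → unit ; unique = η-⊤ }

∧-terminal : ∀ {A B} → Terminal A → Terminal B → Terminal (A ∧ B)
∧-terminal TA TB = record
  { canonical = λ Γ → pair (canonical TA Γ) (canonical TB Γ)
  ; unique    = λ t → ≈-trans (η-∧ t) (pair-cong (unique TA (fst t)) (unique TB (snd t)))
  }

⇒-terminal : ∀ {G A} → Terminal A → Terminal (G ⇒ A)
⇒-terminal {G} TA = record
  { canonical = λ Γ → lam (canonical TA (G ∷ Γ))
  ; unique    = λ t → ≈-trans (η-⇒ t) (lam-cong (unique TA _))
  }

terminal⇒≅⊤ : ∀ {F} → Terminal F → F ≅ ⊤̇
terminal⇒≅⊤ T = record
  { φ      = lam unit
  ; ψ      = lam (canonical T (⊤̇ ∷ []))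
  ; ψ∘φ≈id = lam-cong (terminal-irrelevant T _ _)
  ; φ∘ψ≈id = lam-cong (terminal-irrelevant ⊤-terminal _ _)
  }

⟦⟧≡1⇒terminal : ∀ F → ⟦ F ⟧ ≡ 1 → Terminal F
⟦⟧≡1⇒terminal (atom _) ()
⟦⟧≡1⇒terminal ⊤̇       _ = ⊤-terminal
⟦⟧≡1⇒terminal (F ∧ G) e = ∧-terminal
  (⟦⟧≡1⇒terminal F (m*n≡1⇒m≡1 ⟦ F ⟧ ⟦ G ⟧ e))
  (⟦⟧≡1⇒terminal G (m*n≡1⇒n≡1 ⟦ F ⟧ ⟦ G ⟧ e))
⟦⟧≡1⇒terminal (F ∨ G) e =
  contradiction e (positive-sum≢1 (⟦⟧-positive F) (⟦⟧-positive G))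
⟦⟧≡1⇒terminal (G ⇒ F) e =
  ⇒-terminal (⟦⟧≡1⇒terminal F (positive-power≡1 ⟦ F ⟧ (⟦⟧-positive G) e))

lemma7 : (F : Formula) → ⟦ F ⟧ ≡ 1 → F ≅ ⊤̇
lemma7 F e = terminal⇒≅⊤ (⟦⟧≡1⇒terminal F e)
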